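{- For every label $X$, every formula $\varphi$ and every variable $x$, the sequent $X:\forall x\,\neg\neg\varphi\Rightarrow X:\neg\neg\forall x\,\varphi$ is derivable in $\mathbf{G}(\mathsf{FBInqBQ})$. Therefore the sequent $\Rightarrow X:(\forall x\,\neg\neg\varphi)\to\neg\neg\forall x\,\varphi$ is derivable in $\mathbf{G}(\mathsf{FBInqBQ})$ for every label $X$.
   Context: Language: countably infinite set of variables, countably infinite set of predicate symbols with arities (no identity, constants, function symbols). Formulas: $\varphi ::= P(x_1,\dots,x_m)\mid \bot\mid \varphi\to\varphi\mid\varphi\wedge\varphi\mid \varphi\veebar\varphi\mid \forall x\varphi\mid \bar\exists x\varphi$ ($\veebar$ inquisitive disjunction, $\bar\exists$ inquisitive existential); $\neg\varphi:=\varphi\to\bot$. $\varphi[z/x]$ is capture-avoiding substitution. Calculus $\mathbf{G}(\mathsf{FBInqBQ})$: a label is a nonempty finite subset of $\omega$; a labelled formula is $X:\varphi$ with $X$ a label; a sequent $\Gamma\Rightarrow\Delta$ is a pair of finite multisets of labelled formulas. $X,Y$ range over labels. Initial sequents: $(\mathtt{id})$ $X:P(\bar x),\Gamma\Rightarrow\Delta,Y:P(\bar x)$ whenever $X\supseteq Y$; $(\bot\Rightarrow)$ $X:\bot,\Gamma\Rightarrow\Delta$. Rules (premises / conclusion): $(\Rightarrow\mathtt{at})$: $\Gamma\Rightarrow\Delta,\{k\}:P(\bar x)$ for every $k\in X$ / $\Gamma\Rightarrow\Delta,X:P(\bar x)$. $(\Rightarrow\wedge)$: $\Gamma\Rightarrow\Delta,X:\varphi$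 and $\Gamma\Rightarrow\Delta,X:\psi$ / $\Gamma\Rightarrow\Delta,X:\varphi\wedge\psi$. $(\wedge\Rightarrow)$: $X:\varphi,X:\psi,\Gamma\Rightarrow\Delta$ / $X:\varphi\wedge\psi,\Gamma\Rightarrow\Delta$. $(\Rightarrow\veebar)$: $\Gamma\Rightarrow\Delta,X:\varphi,X:\psi$ / $\Gamma\Rightarrow\Delta,X:\varphi\veebar\psi$. $(\veebar\Rightarrow)$: $X:\varphi,\Gamma\Rightarrow\Delta$ and $X:\psi,\Gamma\Rightarrow\Delta$ / $X:\varphi\veebar\psi,\Gamma\Rightarrow\Delta$. $(\Rightarrow\to)$: $Y:\varphi,\Gamma\Rightarrow\Delta,Y:\psi$ for every label $Y\subseteq X$ / $\Gamma\Rightarrow\Delta,X:\varphi\to\psi$. $(\to\Rightarrow)$, for a label $Y\subseteq X$: $X:\varphi\to\psi,\Gamma\Rightarrow\Delta,Y:\varphi$ and $Y:\psi,X:\varphi\to\psi,\Gamma\Rightarrow\Delta$ / $X:\varphi\to\psi,\Gamma\Rightarrow\Delta$. $(\Rightarrow\forall)$: $\Gamma\Rightarrow\Delta,X:\varphi[z/x]$ / $\Gamma\Rightarrow\Delta,X:\forall x\varphi$, with $z$ not occurring in the conclusion. $(\forall\Rightarrow)$: $X:\varphi[y/x],X:\forall x\varphi,\Gamma\Rightarrow\Delta$ / $X:\forall x\varphi,\Gamma\Rightarrow\Delta$ ($y$ arbitrary). $(\Rightarrow\bar\exists)$: $\Gamma\Rightarrow\Delta,X:\bar\exists x\varphi,X:\varphi[y/x]$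 / $\Gamma\Rightarrow\Delta,X:\bar\exists x\varphi$ ($y$ arbitrary). $(\bar\exists\Rightarrow)$: $X:\varphi[z/x],\Gamma\Rightarrow\Delta$ / $X:\bar\exists x\varphi,\Gamma\Rightarrow\Delta$, with $z$ not occurring in the conclusion. A derivation is a finite tree of sequents built from initial sequents by these rules; a sequent is derivable if it is the root of a derivation. -}

module Defs where

open import Data.Nat using (ℕ; suc; _⊔_; _<_; _≟_)
open import Data.Bool using (if_then_else_)
open import Data.List using (List; []; _∷_; map; filter; foldr; _++_; concatMap)
open import Data.Vec using (Vec; toList)
import Data.Vec as V
open import Data.Product using (_×_; _,_)
open import Data.List.Membership.Propositional using (_∈_; _∉_)
open import Data.List.Membership.DecPropositional _≟_ using (_∈?_)
open import Data.List.Relation.Binary.Subset.Propositional using (_⊆_)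
open import Data.List.Relation.Binary.Permutation.Propositional using (_↭_)
open import Data.List.Relation.Unary.AllPairs using (AllPairs; []; _∷_)
open import Data.List.Relation.Unary.All using ([])
open import Relation.Binary.PropositionalEquality using (_≢_)
open import Relation.Nullary using (¬?)
open import Relation.Nullary.Decidable using (⌊_⌋)

Var : Set
Var = ℕ

-- Predicate symbols: for each arity m, countably many symbols indexed by p : ℕ.
-- The atom  atom m p xs  is P^m_p(x_1,…,x_m).
infixr 6 _⟶_
infixr 7 _∧'_
infixr 7 _⩡_

data Formula : Set where
  atom : (m p : ℕ) → Vec Var m → Formula
  bot  : Formula
  _⟶_  : Formula → Formula → Formula
  _∧'_ : Formula → Formula → Formula
  _⩡_  : Formula → Formula → Formula   -- inquisitive disjunction
  all  : Var → Formula → Formula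
  ex   : Var → Formula → Formula       -- inquisitive existential ∃̄

neg : Formula → Formula
neg φ = φ ⟶ bot

fv : Formula → List Var
fv (atom m p xs) = toList xs
fv bot = []
fv (φ ⟶ ψ) = fv φ ++ fv ψ
fv (φ ∧' ψ) = fv φ ++ fv ψ
fv (φ ⩡ ψ) = fv φ ++ fv ψ
fv (all z φ) = filter (λ v → ¬? (v ≟ z)) (fv φ)
fv (ex z φ) = filter (λ v → ¬? (v ≟ z)) (fv φ)

vars : Formula → List Var
vars (atom m p xs) = toList xs
vars bot = []
vars (φ ⟶ ψ) = vars φ ++ vars ψ
vars (φ ∧' ψ) = vars φ ++ vars ψ
vars (φ ⩡ ψ) = vars φ ++ vars ψ
vars (all z φ) = z ∷ vars φ
vars (ex z φ) = z ∷ vars φ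

upd : (Var → Var) → Var → Var → (Var → Var)
upd σ z w v = if ⌊ v ≟ z ⌋ then w else σ v

maxL : List ℕ → ℕ
maxL = foldr _⊔_ 0

-- the bound variable z is kept unless it would capture, in which case it is
-- renamed to a variable not in σ(FV(Qz.φ))
pick : (Var → Var) → Var → Formula → Var
pick σ z φ =
  let img = map σ (filter (λ v → ¬? (v ≟ z)) (fv φ))
  in if ⌊ z ∈? img ⌋ then suc (maxL img) else z

sub : (Var → Var) → Formula → Formula
sub σ (atom m p xs) = atom m p (V.map σ xs)
sub σ bot = bot
sub σ (φ ⟶ ψ) = sub σ φ ⟶ sub σ ψ
sub σ (φ ∧' ψ) = sub σ φ ∧' sub σ ψ
sub σ (φ ⩡ ψ) = sub σ φ ⩡ sub σ ψ
sub σ (all z φ) = all (pick σ z φ) (sub (upd σ z (pick σ z φ)) φ)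
sub σ (ex z φ) = ex (pick σ z φ) (sub (upd σ z (pick σ z φ)) φ)

_[_/_] : Formula → Var → Var → Formula
φ [ y / x ] = sub (upd (λ v → v) x y) φ

-- Labels: nonempty finite subsets of ω, represented canonically as
-- nonempty strictly increasing lists.

record Label : Set where
  constructor mkLabel
  field
    elems    : List ℕ
    nonempty : elems ≢ []
    sorted   : AllPairs _<_ elems
open Label public

_⊆L_ : Label → Label → Set
Y ⊆L X = elems Y ⊆ elems X

single : ℕ → Label
single k = mkLabel (k ∷ []) (λ ()) ([] ∷ [])

-- Labelled formulas and sequents (multisets as lists modulo permutation)

infix 5 _∶_
LFormula : Set
LFormula = Label × Formula

_∶_ : Label → Formula → LFormula
X ∶ φ = X , φ

varsL : List LFormula → List Var
varsL = concatMap (λ { (_ , φ) → vars φ })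

varsSeq : List LFormula → List LFormula → List Var
varsSeq Γ Δ = varsL Γ ++ varsL Δ

infix 3 _⊢_
data _⊢_ : List LFormula → List LFormula → Set where
  perm : ∀ {Γ Γ' Δ Δ'} → Γ ↭ Γ' → Δ ↭ Δ' → Γ ⊢ Δ → Γ' ⊢ Δ'
  ax-id : ∀ {X Y m p xs Γ Δ} → Y ⊆L X →
          (X ∶ atom m p xs) ∷ Γ ⊢ (Y ∶ atom m p xs) ∷ Δ
  ax-bot : ∀ {X Γ Δ} → (X ∶ bot) ∷ Γ ⊢ Δ
  R-at : ∀ {X m p xs Γ Δ} →
         (∀ k → k ∈ elems X → Γ ⊢ (single k ∶ atom m p xs) ∷ Δ) →
         Γ ⊢ (X ∶ atom m p xs) ∷ Δ
  R-∧ : ∀ {X φ ψ Γ Δ} → Γ ⊢ (X ∶ φ) ∷ Δ → Γ ⊢ (X ∶ ψ) ∷ Δ →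
        Γ ⊢ (X ∶ φ ∧' ψ) ∷ Δ
  L-∧ : ∀ {X φ ψ Γ Δ} → (X ∶ φ) ∷ (X ∶ ψ) ∷ Γ ⊢ Δ →
        (X ∶ φ ∧' ψ) ∷ Γ ⊢ Δ
  R-⩡ : ∀ {X φ ψ Γ Δ} → Γ ⊢ (X ∶ φ) ∷ (X ∶ ψ) ∷ Δ →
        Γ ⊢ (X ∶ φ ⩡ ψ) ∷ Δ
  L-⩡ : ∀ {X φ ψ Γ Δ} → (X ∶ φ) ∷ Γ ⊢ Δ → (X ∶ ψ) ∷ Γ ⊢ Δ →
        (X ∶ φ ⩡ ψ) ∷ Γ ⊢ Δ
  R-⟶ : ∀ {X φ ψ Γ Δ} →
        (∀ Y → Y ⊆L X → (Y ∶ φ) ∷ Γ ⊢ (Y ∶ ψ) ∷ Δ) →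
        Γ ⊢ (X ∶ φ ⟶ ψ) ∷ Δ
  L-⟶ : ∀ {X Y φ ψ Γ Δ} → Y ⊆L X →
        (X ∶ φ ⟶ ψ) ∷ Γ ⊢ (Y ∶ φ) ∷ Δ →
        (Y ∶ ψ) ∷ (X ∶ φ ⟶ ψ) ∷ Γ ⊢ Δ →
        (X ∶ φ ⟶ ψ) ∷ Γ ⊢ Δ
  R-∀ : ∀ {X x z φ Γ Δ} → z ∉ varsSeq Γ ((X ∶ all x φ) ∷ Δ) →
        Γ ⊢ (X ∶ φ [ z / x ]) ∷ Δ →
        Γ ⊢ (X ∶ all x φ) ∷ Δ
  L-∀ : ∀ {X x y φ Γ Δ} →
        (X ∶ φ [ y / x ]) ∷ (X ∶ all x φ) ∷ Γ ⊢ Δ →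
        (X ∶ all x φ) ∷ Γ ⊢ Δ
  R-∃ : ∀ {X x y φ Γ Δ} →
        Γ ⊢ (X ∶ ex x φ) ∷ (X ∶ φ [ y / x ]) ∷ Δ →
        Γ ⊢ (X ∶ ex x φ) ∷ Δ
  L-∃ : ∀ {X x z φ Γ Δ} → z ∉ varsSeq ((X ∶ ex x φ) ∷ Γ) Δ →
        (X ∶ φ [ z / x ]) ∷ Γ ⊢ Δ →
        (X ∶ ex x φ) ∷ Γ ⊢ Δ

{-# OPTIONS --safe #-}
module Submission where

open import Defs
open import Data.List using (List; []; _∷_)
open import Data.List.Extrema.Nat using (max; xs≤max)
open import Data.List.Membership.Propositional using (_∈_; _∉_)
open import Data.List.Relation.Binary.Permutation.Propositional using (refl; swap)
open import Data.List.Relation.Binary.Subset.Propositional.Properties using (⊆-refl; ⊆-trans)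
open import Data.List.Relation.Unary.All as All using ()
open import Data.List.Relation.Unary.Any using (here)
open import Data.Nat using (ℕ; suc; _+_; _<_; s≤s)
open import Data.Nat.Induction using (<-wellFounded)
open import Data.Nat.Properties using (n≮n; m≤m+n; m≤n+m; ≤-reflexive)
open import Data.Product using (_×_; _,_; ∃)
open import Function using (_on_)
open import Induction.WellFounded using (WellFounded; Acc; acc)
open import Level using (0ℓ)
open import Relation.Binary using (Rel)
import Relation.Binary.Construct.On as On
open import Relation.Binary.PropositionalEquality using (_≡_; refl; cong; cong₂)

-- Over a singleton label every nonempty sublabel is the label itself, so there
-- the rule (⇒→) for ¬φ has a single premise and {k}:¬¬φ yields {k}:φ: at
-- singletons the calculus is classical.  Given Y ⊆ X with Y:¬∀xφ, pick k ∈ Y;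
-- it suffices to derive {k}:∀xφ, i.e. {k}:φ[z/x] for a fresh z, and this
-- follows from X:¬¬φ[z/x] by the singleton fact.  The identity sequents
-- X:φ ⇒ Y:φ (Y ⊆ X) needed there are derived by well-founded induction on
-- the size of φ, which substitution preserves.

⊢-swapˡ : ∀ {A B Γ Δ} → A ∷ B ∷ Γ ⊢ Δ → B ∷ A ∷ Γ ⊢ Δ
⊢-swapˡ = perm (swap _ _ refl) refl

⊢-swapʳ : ∀ {A B Γ Δ} → Γ ⊢ A ∷ B ∷ Δ → Γ ⊢ B ∷ A ∷ Δ
⊢-swapʳ = perm refl (swap _ _ refl)

fresh : List Var → Var
fresh vs = suc (max 0 vs)

fresh∉ : ∀ vs → fresh vs ∉ vs
fresh∉ vs fresh∈vs = n≮n _ (All.lookup (xs≤max 0 vs) fresh∈vs)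

R-∀-fresh : ∀ {X x φ Γ Δ} → (∀ z → Γ ⊢ (X ∶ φ [ z / x ]) ∷ Δ) →
            Γ ⊢ (X ∶ all x φ) ∷ Δ
R-∀-fresh ⊢φ[z/x] = R-∀ (fresh∉ _) (⊢φ[z/x] _)

L-∃-fresh : ∀ {X x φ Γ Δ} → (∀ z → (X ∶ φ [ z / x ]) ∷ Γ ⊢ Δ) →
            (X ∶ ex x φ) ∷ Γ ⊢ Δ
L-∃-fresh φ[z/x]⊢ = L-∃ (fresh∉ _) (φ[z/x]⊢ _)

size : Formula → ℕ
size (atom m p xs) = 0
size bot = 0
size (φ ⟶ ψ) = suc (size φ + size ψ)
size (φ ∧' ψ) = suc (size φ + size ψ)
size (φ ⩡ ψ) = suc (size φ + size ψ)
size (all x φ) = suc (size φ)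
size (ex x φ) = suc (size φ)

size-sub : ∀ σ φ → size (sub σ φ) ≡ size φ
size-sub σ (atom m p xs) = refl
size-sub σ bot = refl
size-sub σ (φ ⟶ ψ) = cong₂ (λ m n → suc (m + n)) (size-sub σ φ) (size-sub σ ψ)
size-sub σ (φ ∧' ψ) = cong₂ (λ m n → suc (m + n)) (size-sub σ φ) (size-sub σ ψ)
size-sub σ (φ ⩡ ψ) = cong₂ (λ m n → suc (m + n)) (size-sub σ φ) (size-sub σ ψ)
size-sub σ (all z φ) = cong suc (size-sub (upd σ z (pick σ z φ)) φ)
size-sub σ (ex z φ) = cong suc (size-sub (upd σ z (pick σ z φ)) φ)

_⊏_ : Rel Formula 0ℓ
_⊏_ = _<_ on size

⊏-wellFounded : WellFounded _⊏_
⊏-wellFounded = On.wellFounded size <-wellFounded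

m<1+m+n : ∀ m n → m < suc (m + n)
m<1+m+n m n = s≤s (m≤m+n m n)

n<1+m+n : ∀ m n → n < suc (m + n)
n<1+m+n m n = s≤s (m≤n+m n m)

size-[/]< : ∀ φ y x → size (φ [ y / x ]) < suc (size φ)
size-[/]< φ y x = s≤s (≤-reflexive (size-sub (upd (λ v → v) x y) φ))

label-inhabited : (X : Label) → ∃ λ k → k ∈ elems X
label-inhabited (mkLabel [] nonempty _) with () ← nonempty refl
label-inhabited (mkLabel (k ∷ _) _ _) = k , here refl

single-⊆ : ∀ {k} X → k ∈ elems X → single k ⊆L X
single-⊆ X k∈X (here refl) = k∈X

⊆-single⇒⊇ : ∀ {k} Y → Y ⊆L single k → single k ⊆L Y
⊆-single⇒⊇ Y Y⊆k with label-inhabited Y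
... | j , j∈Y with Y⊆k j∈Y
...   | here refl = single-⊆ Y j∈Y

⊢-id-acc : ∀ φ → Acc _⊏_ φ → ∀ {X Y Γ Δ} → Y ⊆L X → (X ∶ φ) ∷ Γ ⊢ (Y ∶ φ) ∷ Δ
⊢-id-acc (atom m p xs) _ Y⊆X = ax-id Y⊆X
⊢-id-acc bot _ _ = ax-bot
⊢-id-acc (φ ⟶ ψ) (acc rs) Y⊆X = R-⟶ λ Z Z⊆Y → ⊢-swapˡ
  (L-⟶ {Y = Z} (⊆-trans Z⊆Y Y⊆X)
    (⊢-swapˡ (⊢-id-acc φ (rs (m<1+m+n _ _)) ⊆-refl))
    (⊢-id-acc ψ (rs (n<1+m+n _ _)) ⊆-refl))
⊢-id-acc (φ ∧' ψ) (acc rs) Y⊆X = L-∧ (R-∧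
  (⊢-id-acc φ (rs (m<1+m+n _ _)) Y⊆X)
  (⊢-swapˡ (⊢-id-acc ψ (rs (n<1+m+n _ _)) Y⊆X)))
⊢-id-acc (φ ⩡ ψ) (acc rs) Y⊆X = R-⩡ (L-⩡
  (⊢-id-acc φ (rs (m<1+m+n _ _)) Y⊆X)
  (⊢-swapʳ (⊢-id-acc ψ (rs (n<1+m+n _ _)) Y⊆X)))
⊢-id-acc (all x φ) (acc rs) Y⊆X = R-∀-fresh λ z →
  L-∀ (⊢-id-acc (φ [ z / x ]) (rs (size-[/]< φ z x)) Y⊆X)
⊢-id-acc (ex x φ) (acc rs) Y⊆X = L-∃-fresh λ z →
  R-∃ (⊢-swapʳ (⊢-id-acc (φ [ z / x ]) (rs (size-[/]< φ z x)) Y⊆X))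

⊢-id : ∀ φ {X Y Γ Δ} → Y ⊆L X → (X ∶ φ) ∷ Γ ⊢ (Y ∶ φ) ∷ Δ
⊢-id φ = ⊢-id-acc φ (⊏-wellFounded φ)

¬¬-elim-single : ∀ {k X φ Γ Δ} → single k ⊆L X →
                 (X ∶ neg (neg φ)) ∷ Γ ⊢ (single k ∶ φ) ∷ Δ
¬¬-elim-single {k} {φ = φ} k⊆X =
  L-⟶ {Y = single k} k⊆X (R-⟶ λ Y Y⊆k → ⊢-swapʳ (⊢-id φ (⊆-single⇒⊇ Y Y⊆k))) ax-bot

∀¬¬⊢¬¬∀ : ∀ X φ x →
          (X ∶ all x (neg (neg φ))) ∷ [] ⊢ (X ∶ neg (neg (all x φ))) ∷ []
∀¬¬⊢¬¬∀ X φ x = R-⟶ λ Y Y⊆X →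
  let k , k∈Y = label-inhabited Y
      k⊆Y = single-⊆ Y k∈Y
  in L-⟶ k⊆Y
       (R-∀-fresh λ z → ⊢-swapˡ (L-∀ (¬¬-elim-single (⊆-trans k⊆Y Y⊆X))))
       ax-bot

proposition8 : ∀ (X : Label) (φ : Formula) (x : Var) →
    ((X ∶ all x (neg (neg φ))) ∷ [] ⊢ (X ∶ neg (neg (all x φ))) ∷ [])
    × ([] ⊢ (X ∶ all x (neg (neg φ)) ⟶ neg (neg (all x φ))) ∷ [])
proposition8 X φ x = ∀¬¬⊢¬¬∀ X φ x , R-⟶ λ Y _ → ∀¬¬⊢¬¬∀ Y φ x
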